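{- For every $n\ge0$, $\#\mathrm{Av}_n([1234],[1324])=\#\mathrm{Av}_n([1423],[1432])$. Moreover, for $n\ge3$, $\#\mathrm{Av}_n([1234],[1324])=2(n-2)$.
   Context: For a linear permutation $\pi=\pi_1\ldots\pi_n$ of $[n]$, the cyclic permutation $[\pi]$ is the set of all rotations of $\pi$. A linear permutation $\sigma$ contains $\pi$ if some subsequence of $\sigma$ is order isomorphic to $\pi$ (same relative order). A cyclic permutation $[\sigma]$ contains $[\pi]$ if some rotation of $\sigma$ contains $\pi$; otherwise it avoids $[\pi]$. For a set of cyclic patterns $[\Pi]$, $\mathrm{Av}_n[\Pi]$ denotes the set of cyclic permutations of length $n$ avoiding every pattern in $[\Pi]$. -}

module Defs where

open import Data.Nat using (ℕ; zero; suc; _<ᵇ_)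
open import Data.Bool using (Bool; true; false; _∧_; _∨_; not)
open import Data.List using (List; []; _∷_; _++_; map; concatMap; length; filterᵇ; zip; upTo)
open import Data.Bool.ListAction using (all; any)
open import Data.Product using (_×_; _,_; proj₁; proj₂)

_==ᵇ_ : Bool → Bool → Bool
true  ==ᵇ b = b
false ==ᵇ b = not b

insertions : ℕ → List ℕ → List (List ℕ)
insertions x []       = (x ∷ []) ∷ []
insertions x (y ∷ ys) = (x ∷ y ∷ ys) ∷ map (y ∷_) (insertions x ys)

perms : List ℕ → List (List ℕ)
perms []       = [] ∷ []
perms (x ∷ xs) = concatMap (insertions x) (perms xs)

-- the linear permutations of [n], represented on values 0,…,n-1
linPerms : ℕ → List (List ℕ)
linPerms n = perms (upTo n)

subseqs : List ℕ → List (List ℕ)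
subseqs []       = [] ∷ []
subseqs (x ∷ xs) = let r = subseqs xs in map (x ∷_) r ++ r

sameLength : List ℕ → List ℕ → Bool
sameLength []       []       = true
sameLength (_ ∷ xs) (_ ∷ ys) = sameLength xs ys
sameLength _        _        = false

orderIso : List ℕ → List ℕ → Bool
orderIso xs ys =
  sameLength xs ys ∧
  all (λ p → all (λ q → (proj₁ p <ᵇ proj₁ q) ==ᵇ (proj₂ p <ᵇ proj₂ q)) ps) ps
  where ps = zip xs ys

contains : List ℕ → List ℕ → Bool
contains σ π = any (λ s → orderIso s π) (subseqs σ)

rotateBy : ℕ → List ℕ → List ℕ
rotateBy zero    xs       = xs
rotateBy (suc k) []       = []
rotateBy (suc k) (x ∷ xs) = rotateBy k (xs ++ (x ∷ []))

rotations : List ℕ → List (List ℕ)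
rotations xs = map (λ k → rotateBy k xs) (upTo (suc (length xs)))

cycContains : List ℕ → List ℕ → Bool
cycContains σ π = any (λ ρ → contains ρ π) (rotations σ)

cycAvoidsAll : List (List ℕ) → List ℕ → Bool
cycAvoidsAll Π σ = all (λ π → not (cycContains σ π)) Π

-- Each cyclic permutation [σ] of [n] is represented by its unique rotation
-- beginning with the minimum value 0 (for n = 0: the empty permutation).
startsWithMin : List ℕ → Bool
startsWithMin []       = true
startsWithMin (zero ∷ _) = true
startsWithMin (suc _ ∷ _) = false

cycPerms : ℕ → List (List ℕ)
cycPerms n = filterᵇ startsWithMin (linPerms n)

Av : ℕ → List (List ℕ) → List (List ℕ)
Av n Π = filterᵇ (cycAvoidsAll Π) (cycPerms n)

#Av : ℕ → List (List ℕ) → ℕ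
#Av n Π = length (Av n Π)

p1234 p1324 p1423 p1432 : List ℕ
p1234 = 1 ∷ 2 ∷ 3 ∷ 4 ∷ []
p1324 = 1 ∷ 3 ∷ 2 ∷ 4 ∷ []
p1423 = 1 ∷ 4 ∷ 2 ∷ 3 ∷ []
p1432 = 1 ∷ 4 ∷ 3 ∷ 2 ∷ []

module Submission where

-- Write a cyclic permutation of [n + 1] as its rotation 0 ∷ τ. As 0 is the minimum, an occurrence
-- of [1234] or [1324] either uses 0 as its 1 or is an occurrence of one of their rotations inside
-- τ, and 0 ∷ τ avoids both exactly when τ avoids 123, 213, 3412 and 4132 (AvoidsA). Read backwards,
-- the same argument shows that 0 ∷ τ avoids [1423] and [1432] exactly when reverse τ satisfies
-- AvoidsA; reversal permutes the permutations of 1, …, n, which gives the first claim.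
--
-- The permutations of 1, …, n arise by inserting the minimum 1 into those of 2, …, n. Inserting a
-- new minimum into ρ gives an AvoidsA-word exactly when ρ is one and the new entry goes last, or ρ
-- is decreasing and the new entry goes first or just before the last entry. Exactly one
-- permutation is decreasing, so a(m) = #Av_{m+1} (avoidersA) satisfies a(0) = 1 and
-- a(m + 1) = a(m) + min(2, m), whence a(m) = 2(m − 1) for m ≥ 2.

open import Defs

open import Data.Bool using (Bool; true; false; not; _∧_; _∨_; T; T?; if_then_else_)
open import Data.Bool.ListAction using (all)
open import Data.Bool.Properties using (T-∧)
open import Data.Empty using (⊥; ⊥-elim)
open import Data.List using (List; []; _∷_; _++_; null; concat; concatMap; applyUpTo; map; zip; length; take; drop; reverse; filterᵇ)
import Data.List as List
open import Data.List.Membership.Propositional using (_∈_; find; lose)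
open import Data.List.Membership.Propositional.Properties using (∈-map⁺; ∈-map⁻; ∈-++⁺ˡ; ∈-++⁺ʳ; ∈-++⁻; ∈-upTo⁺; ∈-upTo⁻)
open import Data.List.Properties
  using (++-identityʳ; ++-assoc; length-++; length-take; take++drop≡id; length-applyUpTo; map-∘; map-++; map-cong;
         map-concatMap; concatMap-map; filter-++; filter-none; unfold-reverse; reverse-involutive)
import Data.List.Relation.Binary.Permutation.Propositional as ↭
open import Data.List.Relation.Binary.Permutation.Propositional
  using (_↭_; ↭-refl; ↭-sym; ↭-trans; ↭-prep; ↭⇒↭ₛ; module PermutationReasoning)
open import Data.List.Relation.Binary.Permutation.Propositional.Properties
  using (↭-length; ↭-reverse; filter-↭; All-resp-↭; shift; shifts; ∷↭∷ʳ)
  renaming (map⁺ to map⁺-↭; ++⁺ˡ to ++⁺ˡ-↭; ++⁺ to ++⁺-↭)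
open import Data.List.Relation.Binary.Sublist.Propositional using (_⊆_; []; _∷_; _∷ʳ_; ⊆-refl; ⊆-trans; to∈; from∈; minimum)
open import Data.List.Relation.Binary.Sublist.Propositional.Properties using (++⁺; ++⁺ˡ; ++⁺ʳ; All-resp-⊆; reverse⁺)
open import Data.List.Relation.Unary.All using (All; []; _∷_)
import Data.List.Relation.Unary.All as All
open import Data.List.Relation.Unary.All.Properties using (all⁻; all⁺; map⁺; concat⁺; ++⁻ˡ; ++⁻ʳ; applyUpTo⁺₂)
open import Data.List.Relation.Unary.AllPairs using (AllPairs; []; _∷_; allPairs?)
import Data.List.Relation.Unary.AllPairs as AllPairs
import Data.List.Relation.Unary.AllPairs.Properties as AllPairsₚ
open import Data.List.Relation.Unary.Any using (here; there)
open import Data.List.Relation.Unary.Any.Properties using (any⁺; any⁻)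
open import Data.List.Relation.Unary.Unique.Propositional using (Unique)
open import Data.Nat using (ℕ; zero; suc; _+_; _*_; _∸_; _⊓_; _≤_; _<_; _>_; _<?_; _<ᵇ_; z<s; s<s; s≤s; s≤s⁻¹)
open import Data.Nat.Properties
  using (<ᵇ⇒<; <⇒<ᵇ; <-cmp; <-irrefl; <-asym; <-trans; <⇒≢; ≤∧≢⇒<; ≮⇒≥; m≤n⇒m<n∨m≡n; n<1+n; n≮0; m≤m+n;
         m≤n⇒m⊓n≡m; +-identityʳ; +-comm; *-identityʳ; *-zeroʳ; *-suc; *-distribˡ-+; +-commutativeSemigroup)
open import Algebra.Properties.CommutativeSemigroup +-commutativeSemigroup using (interchange)
open import Data.Product using (∃; ∃₂; _×_; _,_; proj₁; proj₂; map₁; uncurry)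
open import Data.Product.Function.NonDependent.Propositional using (_×-⇔_)
open import Data.Sum using (_⊎_; inj₁; inj₂)
open import Data.Unit using (tt)
open import Function using (id; _∘_; _⇔_; mk⇔; Equivalence)
import Function.Properties.Equivalence as ⇔
open import Relation.Binary using (tri<; tri≈; tri>)
open import Relation.Binary.PropositionalEquality
  using (_≡_; _≢_; refl; sym; trans; cong; cong₂; subst; setoid; module ≡-Reasoning)
import Data.List.Relation.Binary.Permutation.Setoid.Properties (setoid ℕ) as ↭ₛ
open import Relation.Nullary using (¬_)
open import Relation.Nullary.Decidable using (isYes; toWitness; fromWitness)

T-injective : ∀ {a b} → T a ⇔ T b → a ≡ b
T-injective {true}  {true}  _   = refl
T-injective {true}  {false} a⇔b = ⊥-elim (Equivalence.to a⇔b tt)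
T-injective {false} {true}  a⇔b = ⊥-elim (Equivalence.from a⇔b tt)
T-injective {false} {false} _   = refl

T-not : ∀ {b} → T (not b) ⇔ (¬ T b)
T-not {true}  = mk⇔ (λ ()) (λ ¬tt → ¬tt tt)
T-not {false} = mk⇔ (λ _ ()) (λ _ → tt)

T-==ᵇ : ∀ {b c} → T (b ==ᵇ c) → T b ⇔ T c
T-==ᵇ {true}  {true}  _ = mk⇔ id id
T-==ᵇ {false} {false} _ = mk⇔ id id

==ᵇ-refl : ∀ b → T (b ==ᵇ b)
==ᵇ-refl true  = tt
==ᵇ-refl false = tt

T-null : ∀ (ys : List ℕ) → T (null ys) ⇔ ys ≡ []
T-null []      = mk⇔ (λ _ → refl) (λ _ → tt)
T-null (_ ∷ _) = mk⇔ (λ ()) (λ ())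

≮∧≢⇒> : ∀ {a b} → ¬ a < b → a ≢ b → b < a
≮∧≢⇒> a≮b a≢b = ≤∧≢⇒< (≮⇒≥ a≮b) (a≢b ∘ sym)

step⇒strictMono : ∀ (f : ℕ → ℕ) → (∀ i → f i < f (suc i)) → ∀ {i j} → i < j → f i < f j
step⇒strictMono f step {i} {suc j} (s≤s i≤j) with m≤n⇒m<n∨m≡n i≤j
... | inj₁ i<j  = <-trans (step⇒strictMono f step i<j) (step j)
... | inj₂ refl = step i

⊆-split : ∀ p {q t : List ℕ} → t ⊆ p ++ q →
  ∃₂ λ t₁ t₂ → t ≡ t₁ ++ t₂ × t₁ ⊆ p × t₂ ⊆ q
⊆-split []      s          = [] , _ , refl , [] , s
⊆-split (x ∷ p) (refl ∷ s) with ⊆-split p s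
... | t₁ , t₂ , refl , s₁ , s₂ = x ∷ t₁ , t₂ , refl , refl ∷ s₁ , s₂
⊆-split (x ∷ p) (.x ∷ʳ s) with ⊆-split p s
... | t₁ , t₂ , refl , s₁ , s₂ = t₁ , t₂ , refl , x ∷ʳ s₁ , s₂

⊆-cut : ∀ t₁ {t₂ σ : List ℕ} → t₁ ++ t₂ ⊆ σ →
  ∃₂ λ σ₁ σ₂ → σ ≡ σ₁ ++ σ₂ × t₁ ⊆ σ₁ × t₂ ⊆ σ₂
⊆-cut []       {σ = σ} s = [] , σ , refl , [] , s
⊆-cut (x ∷ t₁) (refl ∷ s) with ⊆-cut t₁ s
... | σ₁ , σ₂ , refl , s₁ , s₂ = x ∷ σ₁ , σ₂ , refl , refl ∷ s₁ , s₂
⊆-cut (x ∷ t₁) (y ∷ʳ s) with ⊆-cut (x ∷ t₁) s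
... | σ₁ , σ₂ , refl , s₁ , s₂ = y ∷ σ₁ , σ₂ , refl , y ∷ʳ s₁ , s₂

⊆-insert : ∀ p {x q t} → t ⊆ p ++ x ∷ q →
  t ⊆ p ++ q ⊎ ∃₂ λ t₁ t₂ → t ≡ t₁ ++ x ∷ t₂ × t₁ ⊆ p × t₂ ⊆ q
⊆-insert p s with ⊆-split p s
... | t₁ , []     , refl , s₁ , _ ∷ʳ s₂   = inj₁ (++⁺ s₁ s₂)
... | t₁ , _ ∷ t₂ , refl , s₁ , refl ∷ s₂ = inj₂ (t₁ , t₂ , refl , s₁ , s₂)
... | t₁ , t₂     , refl , s₁ , _ ∷ʳ s₂   = inj₁ (++⁺ s₁ s₂)

∈-subseqs⁺ : ∀ {t σ} → t ⊆ σ → t ∈ subseqs σ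
∈-subseqs⁺ []                 = here refl
∈-subseqs⁺ {σ = x ∷ σ} (refl ∷ s) = ∈-++⁺ˡ (∈-map⁺ (x ∷_) (∈-subseqs⁺ s))
∈-subseqs⁺ {σ = x ∷ σ} (.x ∷ʳ s)  = ∈-++⁺ʳ (map (x ∷_) (subseqs σ)) (∈-subseqs⁺ s)

∈-subseqs⁻ : ∀ σ {t} → t ∈ subseqs σ → t ⊆ σ
∈-subseqs⁻ []      (here refl) = []
∈-subseqs⁻ (x ∷ σ) t∈ with ∈-++⁻ (map (x ∷_) (subseqs σ)) t∈
... | inj₁ t∈map with ∈-map⁻ (x ∷_) t∈map
...   | _ , t′∈ , refl = refl ∷ ∈-subseqs⁻ σ t′∈
∈-subseqs⁻ (x ∷ σ) t∈ | inj₂ t∈′ = x ∷ʳ ∈-subseqs⁻ σ t∈′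

⊆-reverse⁻ : ∀ {t} (τ : List ℕ) → t ⊆ reverse τ → reverse t ⊆ τ
⊆-reverse⁻ τ s = subst (_ ⊆_) (reverse-involutive τ) (reverse⁺ s)

AllPairs-⊆ : ∀ {R : ℕ → ℕ → Set} {τ a b} → AllPairs R τ → a ∷ b ∷ [] ⊆ τ → R a b
AllPairs-⊆ (Ra ∷ _)  (refl ∷ s) = All.lookup Ra (to∈ s)
AllPairs-⊆ (_ ∷ Rτ)  (_ ∷ʳ s)   = AllPairs-⊆ Rτ s

⊆-AllPairs : ∀ {R : ℕ → ℕ → Set} τ → (∀ {a b} → a ∷ b ∷ [] ⊆ τ → R a b) → AllPairs R τ
⊆-AllPairs []      R-pairs = []
⊆-AllPairs (y ∷ τ) R-pairs =
  All.tabulate (λ b∈ → R-pairs (refl ∷ from∈ b∈)) ∷ ⊆-AllPairs τ (λ s → R-pairs (y ∷ʳ s))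

no-pair-in-singleton : ∀ {a b : ℕ} {zs} → length zs ≡ 1 → ¬ a ∷ b ∷ [] ⊆ zs
no-pair-in-singleton {zs = _ ∷ []} _ (_ ∷ ())
no-pair-in-singleton {zs = _ ∷ []} _ (_ ∷ʳ ())

-- Order isomorphism and cyclic containment

orderIso-< : ∀ s π → T (orderIso s π) →
  ∀ {x i y j} → (x , i) ∈ zip s π → (y , j) ∈ zip s π → T (i <ᵇ j) → x < y
orderIso-< s π o {x} xi∈ yj∈ i<j =
  <ᵇ⇒< x _ (Equivalence.from (T-==ᵇ (All.lookup (all⁺ _ _ (All.lookup (all⁺ _ _ pairs) xi∈)) yj∈)) i<j)
  where pairs = proj₂ (Equivalence.to T-∧ o)

orderIso-length4 : ∀ t {i₁ i₂ i₃ i₄} → T (orderIso t (i₁ ∷ i₂ ∷ i₃ ∷ i₄ ∷ [])) →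
  ∃ λ a → ∃ λ b → ∃ λ c → ∃ λ d → t ≡ a ∷ b ∷ c ∷ d ∷ []
orderIso-length4 (a ∷ b ∷ c ∷ d ∷ []) _ = a , b , c , d , refl
orderIso-length4 [] ()
orderIso-length4 (_ ∷ []) ()
orderIso-length4 (_ ∷ _ ∷ []) ()
orderIso-length4 (_ ∷ _ ∷ _ ∷ []) ()
orderIso-length4 (_ ∷ _ ∷ _ ∷ _ ∷ _ ∷ _) ()

<ᵇ-preserved : ∀ (h : ℕ → ℕ) {P : ℕ → Set} → (∀ {i j} → P i → P j → i < j → h i < h j) →
  ∀ {i j} → P i → P j → (h i <ᵇ h j) ≡ (i <ᵇ j)
<ᵇ-preserved h mono {i} {j} pi pj = T-injective (mk⇔ to (<⇒<ᵇ ∘ mono pi pj ∘ <ᵇ⇒< i j))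
  where
  to : T (h i <ᵇ h j) → T (i <ᵇ j)
  to hi<hj with <-cmp i j
  ... | tri< i<j _ _ = <⇒<ᵇ i<j
  ... | tri≈ _ refl _ = ⊥-elim (<-irrefl refl (<ᵇ⇒< (h i) (h j) hi<hj))
  ... | tri> _ _ j<i = ⊥-elim (<-asym (<ᵇ⇒< (h i) (h j) hi<hj) (mono pj pi j<i))

sameLength-map : ∀ (h : ℕ → ℕ) π → T (sameLength (map h π) π)
sameLength-map h []      = tt
sameLength-map h (_ ∷ π) = sameLength-map h π

zip-map-self : ∀ (h : ℕ → ℕ) π → zip (map h π) π ≡ map (λ i → h i , i) π
zip-map-self h []      = refl
zip-map-self h (i ∷ π) = cong ((h i , i) ∷_) (zip-map-self h π)

orderIso-map : ∀ (h : ℕ → ℕ) π → (∀ {i j} → i ∈ π → j ∈ π → i < j → h i < h j) →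
  T (orderIso (map h π) π)
orderIso-map h π mono = Equivalence.from T-∧ (sameLength-map h π , all⁻ _ (on-pairs (map⁺ (All.tabulate row))))
  where
  on-pairs : ∀ {P} → All P (map (λ i → h i , i) π) → All P (zip (map h π) π)
  on-pairs = subst (All _) (sym (zip-map-self h π))
  comparable : ∀ {i j} → i ∈ π → j ∈ π → T ((h i <ᵇ h j) ==ᵇ (i <ᵇ j))
  comparable {i} {j} i∈ j∈ = subst (λ b → T ((h i <ᵇ h j) ==ᵇ b)) (<ᵇ-preserved h mono i∈ j∈) (==ᵇ-refl (h i <ᵇ h j))
  row : ∀ {i} → i ∈ π → T (all (λ q → (h i <ᵇ proj₁ q) ==ᵇ (i <ᵇ proj₂ q)) (zip (map h π) π))
  row i∈ = all⁻ _ (on-pairs (map⁺ (All.tabulate (comparable i∈))))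

-- The last clause reads k + d rather than d + k so that the value at 4 is d definitionally.
interpolate : ℕ → ℕ → ℕ → ℕ → ℕ → ℕ
interpolate a b c d zero                      = a
interpolate a b c d 1                         = a
interpolate a b c d 2                         = b
interpolate a b c d 3                         = c
interpolate a b c d (suc (suc (suc (suc k)))) = k + d

orderIso-interpolate : ∀ {a b c d} → a < b → b < c → c < d → ∀ π → All (0 <_) π →
  T (orderIso (map (interpolate a b c d) π) π)
orderIso-interpolate {a} {b} {c} {d} a<b b<c c<d π pos =
  orderIso-map (interpolate a b c d) π λ i∈ j∈ i<j → positive-mono (All.lookup pos i∈) i<j
  where
  step : ∀ i → interpolate a b c d (suc i) < interpolate a b c d (suc (suc i))
  step 0                   = a<b
  step 1                   = b<c
  step 2                   = c<d
  step (suc (suc (suc k))) = n<1+n (k + d)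
  positive-mono : ∀ {i j} → 0 < i → i < j → interpolate a b c d i < interpolate a b c d j
  positive-mono {suc i} {suc j} _ (s≤s i<j) = step⇒strictMono (interpolate a b c d ∘ suc) step i<j

contains⇔ : ∀ σ π → T (contains σ π) ⇔ ∃ λ t → t ⊆ σ × T (orderIso t π)
contains⇔ σ π = mk⇔ to from
  where
  to : T (contains σ π) → ∃ λ t → t ⊆ σ × T (orderIso t π)
  to c with find (any⁻ _ (subseqs σ) c)
  ... | t , t∈ , o = t , ∈-subseqs⁻ σ t∈ , o
  from : (∃ λ t → t ⊆ σ × T (orderIso t π)) → T (contains σ π)
  from (t , s , o) = any⁺ _ (lose (∈-subseqs⁺ s) o)

rotateBy-++ : ∀ (xs ys : List ℕ) → rotateBy (length xs) (xs ++ ys) ≡ ys ++ xs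
rotateBy-++ []       ys = sym (++-identityʳ ys)
rotateBy-++ (x ∷ xs) ys = begin
  rotateBy (length xs) ((xs ++ ys) ++ x ∷ [])  ≡⟨ cong (rotateBy (length xs)) (++-assoc xs ys (x ∷ [])) ⟩
  rotateBy (length xs) (xs ++ (ys ++ x ∷ []))  ≡⟨ rotateBy-++ xs (ys ++ x ∷ []) ⟩
  (ys ++ x ∷ []) ++ xs                         ≡⟨ ++-assoc ys (x ∷ []) xs ⟩
  ys ++ x ∷ xs                                 ∎
  where open ≡-Reasoning

rotateBy-take-drop : ∀ {k} σ → k ≤ length σ → rotateBy k σ ≡ drop k σ ++ take k σ
rotateBy-take-drop {k} σ k≤ = begin
  rotateBy k σ                                         ≡⟨ cong₂ rotateBy (sym length-take-k) (sym (take++drop≡id k σ)) ⟩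
  rotateBy (length (take k σ)) (take k σ ++ drop k σ)  ≡⟨ rotateBy-++ (take k σ) (drop k σ) ⟩
  drop k σ ++ take k σ                                 ∎
  where
  open ≡-Reasoning
  length-take-k : length (take k σ) ≡ k
  length-take-k = trans (length-take k σ) (m≤n⇒m⊓n≡m k≤)

CyclicSublist : List ℕ → List ℕ → Set
CyclicSublist t σ = ∃₂ λ u v → t ≡ u ++ v × v ++ u ⊆ σ

cycContains⇔ : ∀ σ π → T (cycContains σ π) ⇔ ∃ λ t → CyclicSublist t σ × T (orderIso t π)
cycContains⇔ σ π = mk⇔ to from
  where
  to : T (cycContains σ π) → ∃ λ t → CyclicSublist t σ × T (orderIso t π)
  to c with find (any⁻ _ (rotations σ) c)
  ... | ρ , ρ∈ , cρ with ∈-map⁻ (λ k → rotateBy k σ) ρ∈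
  ...   | k , k∈ , refl with Equivalence.to (contains⇔ _ π) cρ
  ...     | t , t⊆ , o with ⊆-split (drop k σ) (subst (t ⊆_) (rotateBy-take-drop σ (s≤s⁻¹ (∈-upTo⁻ k∈))) t⊆)
  ...       | u , v , refl , u⊆ , v⊆ =
    u ++ v , (u , v , refl , subst (v ++ u ⊆_) (take++drop≡id k σ) (++⁺ v⊆ u⊆)) , o
  from : (∃ λ t → CyclicSublist t σ × T (orderIso t π)) → T (cycContains σ π)
  from (t , (u , v , refl , s) , o) with ⊆-cut v s
  ... | σ₁ , σ₂ , refl , v⊆ , u⊆ =
    any⁺ _ (lose rotation∈ (Equivalence.from (contains⇔ _ π) (u ++ v , t⊆ , o)))
    where
    t⊆ : u ++ v ⊆ rotateBy (length σ₁) (σ₁ ++ σ₂)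
    t⊆ = subst (u ++ v ⊆_) (sym (rotateBy-++ σ₁ σ₂)) (++⁺ u⊆ v⊆)
    rotation∈ : rotateBy (length σ₁) (σ₁ ++ σ₂) ∈ rotations (σ₁ ++ σ₂)
    rotation∈ = ∈-map⁺ (λ k → rotateBy k (σ₁ ++ σ₂)) (∈-upTo⁺ (s≤s |σ₁|≤))
      where |σ₁|≤ = subst (length σ₁ ≤_) (sym (length-++ σ₁)) (m≤m+n _ _)

cycContains4⇒ : ∀ σ {i₁ i₂ i₃ i₄} → let π = i₁ ∷ i₂ ∷ i₃ ∷ i₄ ∷ [] in T (cycContains σ π) →
  ∃ λ a → ∃ λ b → ∃ λ c → ∃ λ d →
    CyclicSublist (a ∷ b ∷ c ∷ d ∷ []) σ × T (orderIso (a ∷ b ∷ c ∷ d ∷ []) π)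
cycContains4⇒ σ occ with Equivalence.to (cycContains⇔ σ _) occ
... | t , cyc , o with orderIso-length4 t o
... | a , b , c , d , refl = a , b , c , d , cyc , o

cyclicOccurrence : ∀ u v {σ} π → v ++ u ⊆ σ → T (orderIso (u ++ v) π) → T (cycContains σ π)
cyclicOccurrence u v π s o = Equivalence.from (cycContains⇔ _ π) (u ++ v , (u , v , refl , s) , o)

cycAvoidsAll⇔ : ∀ Π σ → T (cycAvoidsAll Π σ) ⇔ All (λ π → ¬ T (cycContains σ π)) Π
cycAvoidsAll⇔ Π σ = mk⇔ (All.map (Equivalence.to T-not) ∘ all⁺ _ Π)
                        (all⁻ _ ∘ All.map (Equivalence.from T-not))

Is123 Is213 : List ℕ → Set
Is123 (a ∷ b ∷ c ∷ []) = a < b × b < c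
Is123 _                = ⊥
Is213 (a ∷ b ∷ c ∷ []) = b < a × a < c
Is213 _                = ⊥

Is3412 Is4132 : List ℕ → Set
Is3412 (a ∷ b ∷ c ∷ d ∷ []) = c < d × d < a × a < b
Is3412 _                    = ⊥
Is4132 (a ∷ b ∷ c ∷ d ∷ []) = b < d × d < c × c < a
Is4132 _                    = ⊥

Occurs : (List ℕ → Set) → List ℕ → Set
Occurs P τ = ∃ λ t → t ⊆ τ × P t

Occurs-⊆ : ∀ {P : List ℕ → Set} {τ τ′} → τ ⊆ τ′ → Occurs P τ → Occurs P τ′
Occurs-⊆ s (t , t⊆ , pt) = t , ⊆-trans t⊆ s , pt

Occurs-reverse : ∀ {P : List ℕ → Set} {t τ} → t ⊆ τ → P (reverse t) → Occurs P (reverse τ)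
Occurs-reverse s p = _ , reverse⁺ s , p

AvoidsA : List ℕ → Set
AvoidsA τ = ¬ Occurs Is123 τ × ¬ Occurs Is213 τ × ¬ Occurs Is3412 τ × ¬ Occurs Is4132 τ

AvoidsA-⊆ : ∀ {τ τ′} → τ ⊆ τ′ → AvoidsA τ′ → AvoidsA τ
AvoidsA-⊆ s (no123 , no213 , no3412 , no4132) =
  no123 ∘ Occurs-⊆ s , no213 ∘ Occurs-⊆ s , no3412 ∘ Occurs-⊆ s , no4132 ∘ Occurs-⊆ s

Decreasing : List ℕ → Set
Decreasing = AllPairs _>_

decreasing : List ℕ → Bool
decreasing τ = isYes (allPairs? (λ a b → b <? a) τ)

T-decreasing : ∀ τ → T (decreasing τ) ⇔ Decreasing τ
T-decreasing τ = mk⇔ toWitness fromWitness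

Decreasing⇒AvoidsA : ∀ {τ} → Decreasing τ → AvoidsA τ
Decreasing⇒AvoidsA {τ} dec = no123 , no213 , no3412 , no4132
  where
  no-ascent : ∀ {a b t} → a ∷ b ∷ [] ⊆ t → t ⊆ τ → ¬ a < b
  no-ascent ab⊆t t⊆τ a<b = <-asym a<b (AllPairs-⊆ dec (⊆-trans ab⊆t t⊆τ))
  no123 : ¬ Occurs Is123 τ
  no123 (_ ∷ _ ∷ _ ∷ [] , s , a<b , _) = no-ascent (refl ∷ refl ∷ _ ∷ʳ []) s a<b
  no213 : ¬ Occurs Is213 τ
  no213 (_ ∷ _ ∷ _ ∷ [] , s , _ , a<c) = no-ascent (refl ∷ _ ∷ʳ refl ∷ []) s a<c
  no3412 : ¬ Occurs Is3412 τ
  no3412 (_ ∷ _ ∷ _ ∷ _ ∷ [] , s , _ , _ , a<b) = no-ascent (refl ∷ refl ∷ _ ∷ʳ _ ∷ʳ []) s a<b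
  no4132 : ¬ Occurs Is4132 τ
  no4132 (_ ∷ _ ∷ _ ∷ _ ∷ [] , s , b<d , _ , _) = no-ascent (_ ∷ʳ refl ∷ _ ∷ʳ refl ∷ []) s b<d

-- Cyclic avoidance by the representatives 0 ∷ τ

ΠA ΠB : List (List ℕ)
ΠA = p1234 ∷ p1324 ∷ []
ΠB = p1423 ∷ p1432 ∷ []

cycAvoidsA cycAvoidsB : List ℕ → Bool
cycAvoidsA τ = cycAvoidsAll ΠA (0 ∷ τ)
cycAvoidsB τ = cycAvoidsAll ΠB (0 ∷ τ)

positive-pattern : ∀ {i₁ i₂ i₃ i₄} → All (0 <_) (suc i₁ ∷ suc i₂ ∷ suc i₃ ∷ suc i₄ ∷ [])
positive-pattern = z<s ∷ z<s ∷ z<s ∷ z<s ∷ []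

cycAvoidsA⇒AvoidsA : ∀ τ → All (0 <_) τ → T (cycAvoidsA τ) → AvoidsA τ
cycAvoidsA⇒AvoidsA τ 0<τ av = no123 , no213 , no3412 , no4132
  where
  ¬1234 : ¬ T (cycContains (0 ∷ τ) p1234)
  ¬1234 = All.head (Equivalence.to (cycAvoidsAll⇔ ΠA (0 ∷ τ)) av)
  ¬1324 : ¬ T (cycContains (0 ∷ τ) p1324)
  ¬1324 = All.head (All.tail (Equivalence.to (cycAvoidsAll⇔ ΠA (0 ∷ τ)) av))
  no123 : ¬ Occurs Is123 τ
  no123 (_ ∷ _ ∷ _ ∷ [] , s , a<b , b<c) with All-resp-⊆ s 0<τ
  ... | 0<a ∷ _ =
      ¬1234 (cyclicOccurrence [] _ p1234 (refl ∷ s)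
        (orderIso-interpolate 0<a a<b b<c p1234 positive-pattern))
  no213 : ¬ Occurs Is213 τ
  no213 (_ ∷ _ ∷ _ ∷ [] , s , b<a , a<c) with All-resp-⊆ s 0<τ
  ... | _ ∷ 0<b ∷ _ =
      ¬1324 (cyclicOccurrence [] _ p1324 (refl ∷ s)
        (orderIso-interpolate 0<b b<a a<c p1324 positive-pattern))
  no3412 : ¬ Occurs Is3412 τ
  no3412 (a ∷ b ∷ c ∷ d ∷ [] , s , c<d , d<a , a<b) =
    ¬1234 (cyclicOccurrence (c ∷ d ∷ []) (a ∷ b ∷ []) p1234 (0 ∷ʳ s)
      (orderIso-interpolate c<d d<a a<b p1234 positive-pattern))
  no4132 : ¬ Occurs Is4132 τ
  no4132 (a ∷ b ∷ c ∷ d ∷ [] , s , b<d , d<c , c<a) =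
    ¬1324 (cyclicOccurrence (b ∷ c ∷ d ∷ []) (a ∷ []) p1324 (0 ∷ʳ s)
      (orderIso-interpolate b<d d<c c<a p1324 positive-pattern))

pattern 1st = here refl
pattern 2nd = there 1st
pattern 3rd = there 2nd
pattern 4th = there 3rd

-- In each rotation of the occurrence, its first entry is either the 0 of 0 ∷ τ, which can only
-- play the role of the pattern's 1, or an entry of τ; either way a linear pattern appears in τ.
no-cyclic-1234 : ∀ {τ a b c d} → AvoidsA τ → a < b → b < c → c < d →
  ¬ CyclicSublist (a ∷ b ∷ c ∷ d ∷ []) (0 ∷ τ)
no-cyclic-1234 {τ} {a} {b} {c} {d} (no123 , _ , no3412 , _) a<b b<c c<d = refute
  where
  unrotated : ¬ (a ∷ b ∷ c ∷ d ∷ []) ⊆ 0 ∷ τ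
  unrotated (refl ∷ s) = no123 (_ , s , b<c , c<d)
  unrotated (_ ∷ʳ s)   = no123 (_ , ⊆-trans (refl ∷ refl ∷ refl ∷ _ ∷ʳ []) s , a<b , b<c)
  refute : ¬ CyclicSublist (a ∷ b ∷ c ∷ d ∷ []) (0 ∷ τ)
  refute ([] , _ , refl , s)                    = unrotated s
  refute (_ ∷ [] , _ , refl , refl ∷ _)         = n≮0 a<b
  refute (_ ∷ [] , _ , refl , _ ∷ʳ s)           = no123 (_ , ⊆-trans (refl ∷ refl ∷ refl ∷ _ ∷ʳ []) s , b<c , c<d)
  refute (_ ∷ _ ∷ [] , _ , refl , refl ∷ _)     = n≮0 (<-trans a<b b<c)
  refute (_ ∷ _ ∷ [] , _ , refl , _ ∷ʳ s)       = no3412 (_ , s , a<b , b<c , c<d)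
  refute (_ ∷ _ ∷ _ ∷ [] , _ , refl , refl ∷ _) = n≮0 (<-trans a<b (<-trans b<c c<d))
  refute (_ ∷ _ ∷ _ ∷ [] , _ , refl , _ ∷ʳ s)   = no123 (_ , ⊆-trans (_ ∷ʳ refl ∷ refl ∷ refl ∷ []) s , a<b , b<c)
  refute (_ ∷ _ ∷ _ ∷ _ ∷ [] , [] , refl , s)   = unrotated s
  refute (_ ∷ _ ∷ _ ∷ _ ∷ _ ∷ _ , _ , () , _)

no-cyclic-1324 : ∀ {τ a b c d} → AvoidsA τ → a < c → c < b → b < d →
  ¬ CyclicSublist (a ∷ b ∷ c ∷ d ∷ []) (0 ∷ τ)
no-cyclic-1324 {τ} {a} {b} {c} {d} (_ , no213 , _ , no4132) a<c c<b b<d = refute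
  where
  unrotated : ¬ (a ∷ b ∷ c ∷ d ∷ []) ⊆ 0 ∷ τ
  unrotated (refl ∷ s) = no213 (_ , s , c<b , b<d)
  unrotated (_ ∷ʳ s)   = no213 (_ , ⊆-trans (_ ∷ʳ refl ∷ refl ∷ refl ∷ []) s , c<b , b<d)
  refute : ¬ CyclicSublist (a ∷ b ∷ c ∷ d ∷ []) (0 ∷ τ)
  refute ([] , _ , refl , s)                    = unrotated s
  refute (_ ∷ [] , _ , refl , refl ∷ _)         = n≮0 (<-trans a<c c<b)
  refute (_ ∷ [] , _ , refl , _ ∷ʳ s)           = no213 (_ , ⊆-trans (refl ∷ refl ∷ refl ∷ _ ∷ʳ []) s , c<b , b<d)
  refute (_ ∷ _ ∷ [] , _ , refl , refl ∷ _)     = n≮0 a<c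
  refute (_ ∷ _ ∷ [] , _ , refl , _ ∷ʳ s)       = no213 (_ , ⊆-trans (refl ∷ _ ∷ʳ refl ∷ refl ∷ []) s , a<c , c<b)
  refute (_ ∷ _ ∷ _ ∷ [] , _ , refl , refl ∷ _) = n≮0 (<-trans a<c (<-trans c<b b<d))
  refute (_ ∷ _ ∷ _ ∷ [] , _ , refl , _ ∷ʳ s)   = no4132 (_ , s , a<c , c<b , b<d)
  refute (_ ∷ _ ∷ _ ∷ _ ∷ [] , [] , refl , s)   = unrotated s
  refute (_ ∷ _ ∷ _ ∷ _ ∷ _ ∷ _ , _ , () , _)

AvoidsA⇒cycAvoidsA : ∀ τ → AvoidsA τ → T (cycAvoidsA τ)
AvoidsA⇒cycAvoidsA τ av = Equivalence.from (cycAvoidsAll⇔ ΠA (0 ∷ τ)) (¬1234 ∷ ¬1324 ∷ [])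
  where
  ¬1234 : ¬ T (cycContains (0 ∷ τ) p1234)
  ¬1234 occ with cycContains4⇒ (0 ∷ τ) occ
  ... | a , b , c , d , cyc , o =
    no-cyclic-1234 av (order 1st 2nd tt) (order 2nd 3rd tt) (order 3rd 4th tt) cyc
    where order = orderIso-< (a ∷ b ∷ c ∷ d ∷ []) p1234 o
  ¬1324 : ¬ T (cycContains (0 ∷ τ) p1324)
  ¬1324 occ with cycContains4⇒ (0 ∷ τ) occ
  ... | a , b , c , d , cyc , o =
    no-cyclic-1324 av (order 1st 3rd tt) (order 3rd 2nd tt) (order 2nd 4th tt) cyc
    where order = orderIso-< (a ∷ b ∷ c ∷ d ∷ []) p1324 o

T-cycAvoidsA : ∀ τ → All (0 <_) τ → T (cycAvoidsA τ) ⇔ AvoidsA τ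
T-cycAvoidsA τ 0<τ = mk⇔ (cycAvoidsA⇒AvoidsA τ 0<τ) (AvoidsA⇒cycAvoidsA τ)

cycAvoidsB⇒AvoidsA-reverse : ∀ τ → All (0 <_) τ → T (cycAvoidsB τ) → AvoidsA (reverse τ)
cycAvoidsB⇒AvoidsA-reverse τ 0<τ av = no123 , no213 , no3412 , no4132
  where
  ¬1423 : ¬ T (cycContains (0 ∷ τ) p1423)
  ¬1423 = All.head (Equivalence.to (cycAvoidsAll⇔ ΠB (0 ∷ τ)) av)
  ¬1432 : ¬ T (cycContains (0 ∷ τ) p1432)
  ¬1432 = All.head (All.tail (Equivalence.to (cycAvoidsAll⇔ ΠB (0 ∷ τ)) av))
  no123 : ¬ Occurs Is123 (reverse τ)
  no123 (_ ∷ _ ∷ _ ∷ [] , s , a<b , b<c) with ⊆-reverse⁻ τ s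
  ... | s′ with All-resp-⊆ s′ 0<τ
  ... | _ ∷ _ ∷ 0<a ∷ _ =
      ¬1432 (cyclicOccurrence [] _ p1432 (refl ∷ s′)
        (orderIso-interpolate 0<a a<b b<c p1432 positive-pattern))
  no213 : ¬ Occurs Is213 (reverse τ)
  no213 (_ ∷ _ ∷ _ ∷ [] , s , b<a , a<c) with ⊆-reverse⁻ τ s
  ... | s′ with All-resp-⊆ s′ 0<τ
  ... | _ ∷ 0<b ∷ _ =
      ¬1423 (cyclicOccurrence [] _ p1423 (refl ∷ s′)
        (orderIso-interpolate 0<b b<a a<c p1423 positive-pattern))
  no3412 : ¬ Occurs Is3412 (reverse τ)
  no3412 (a ∷ b ∷ c ∷ d ∷ [] , s , c<d , d<a , a<b) =
    ¬1432 (cyclicOccurrence (c ∷ b ∷ a ∷ []) (d ∷ []) p1432 (0 ∷ʳ ⊆-reverse⁻ τ s)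
      (orderIso-interpolate c<d d<a a<b p1432 positive-pattern))
  no4132 : ¬ Occurs Is4132 (reverse τ)
  no4132 (a ∷ b ∷ c ∷ d ∷ [] , s , b<d , d<c , c<a) =
    ¬1423 (cyclicOccurrence (b ∷ a ∷ []) (d ∷ c ∷ []) p1423 (0 ∷ʳ ⊆-reverse⁻ τ s)
      (orderIso-interpolate b<d d<c c<a p1423 positive-pattern))

no-cyclic-1423 : ∀ {τ a b c d} → AvoidsA (reverse τ) → a < c → c < d → d < b →
  ¬ CyclicSublist (a ∷ b ∷ c ∷ d ∷ []) (0 ∷ τ)
no-cyclic-1423 {τ} {a} {b} {c} {d} (_ , no213 , _ , no4132) a<c c<d d<b = refute
  where
  unrotated : ¬ (a ∷ b ∷ c ∷ d ∷ []) ⊆ 0 ∷ τ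
  unrotated (refl ∷ s) = no213 (Occurs-reverse s (c<d , d<b))
  unrotated (_ ∷ʳ s)   = no213 (Occurs-reverse (⊆-trans (_ ∷ʳ refl ∷ refl ∷ refl ∷ []) s) (c<d , d<b))
  refute : ¬ CyclicSublist (a ∷ b ∷ c ∷ d ∷ []) (0 ∷ τ)
  refute ([] , _ , refl , s)                    = unrotated s
  refute (_ ∷ [] , _ , refl , refl ∷ _)         = n≮0 (<-trans a<c (<-trans c<d d<b))
  refute (_ ∷ [] , _ , refl , _ ∷ʳ s)           = no213 (Occurs-reverse (⊆-trans (refl ∷ refl ∷ refl ∷ _ ∷ʳ []) s) (c<d , d<b))
  refute (_ ∷ _ ∷ [] , _ , refl , refl ∷ _)     = n≮0 a<c
  refute (_ ∷ _ ∷ [] , _ , refl , _ ∷ʳ s)       = no4132 (Occurs-reverse s (a<c , c<d , d<b))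
  refute (_ ∷ _ ∷ _ ∷ [] , _ , refl , refl ∷ _) = n≮0 (<-trans a<c c<d)
  refute (_ ∷ _ ∷ _ ∷ [] , _ , refl , _ ∷ʳ s)   = no213 (Occurs-reverse (⊆-trans (refl ∷ refl ∷ _ ∷ʳ refl ∷ []) s) (a<c , c<d))
  refute (_ ∷ _ ∷ _ ∷ _ ∷ [] , [] , refl , s)   = unrotated s
  refute (_ ∷ _ ∷ _ ∷ _ ∷ _ ∷ _ , _ , () , _)

no-cyclic-1432 : ∀ {τ a b c d} → AvoidsA (reverse τ) → a < d → d < c → c < b →
  ¬ CyclicSublist (a ∷ b ∷ c ∷ d ∷ []) (0 ∷ τ)
no-cyclic-1432 {τ} {a} {b} {c} {d} (no123 , _ , no3412 , _) a<d d<c c<b = refute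
  where
  unrotated : ¬ (a ∷ b ∷ c ∷ d ∷ []) ⊆ 0 ∷ τ
  unrotated (refl ∷ s) = no123 (Occurs-reverse s (d<c , c<b))
  unrotated (_ ∷ʳ s)   = no123 (Occurs-reverse (⊆-trans (_ ∷ʳ refl ∷ refl ∷ refl ∷ []) s) (d<c , c<b))
  refute : ¬ CyclicSublist (a ∷ b ∷ c ∷ d ∷ []) (0 ∷ τ)
  refute ([] , _ , refl , s)                    = unrotated s
  refute (_ ∷ [] , _ , refl , refl ∷ _)         = n≮0 (<-trans a<d (<-trans d<c c<b))
  refute (_ ∷ [] , _ , refl , _ ∷ʳ s)           = no123 (Occurs-reverse (⊆-trans (refl ∷ refl ∷ refl ∷ _ ∷ʳ []) s) (d<c , c<b))
  refute (_ ∷ _ ∷ [] , _ , refl , refl ∷ _)     = n≮0 (<-trans a<d d<c)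
  refute (_ ∷ _ ∷ [] , _ , refl , _ ∷ʳ s)       = no123 (Occurs-reverse (⊆-trans (refl ∷ refl ∷ refl ∷ _ ∷ʳ []) s) (a<d , d<c))
  refute (_ ∷ _ ∷ _ ∷ [] , _ , refl , refl ∷ _) = n≮0 a<d
  refute (_ ∷ _ ∷ _ ∷ [] , _ , refl , _ ∷ʳ s)   = no3412 (Occurs-reverse s (a<d , d<c , c<b))
  refute (_ ∷ _ ∷ _ ∷ _ ∷ [] , [] , refl , s)   = unrotated s
  refute (_ ∷ _ ∷ _ ∷ _ ∷ _ ∷ _ , _ , () , _)

AvoidsA-reverse⇒cycAvoidsB : ∀ τ → AvoidsA (reverse τ) → T (cycAvoidsB τ)
AvoidsA-reverse⇒cycAvoidsB τ av = Equivalence.from (cycAvoidsAll⇔ ΠB (0 ∷ τ)) (¬1423 ∷ ¬1432 ∷ [])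
  where
  ¬1423 : ¬ T (cycContains (0 ∷ τ) p1423)
  ¬1423 occ with cycContains4⇒ (0 ∷ τ) occ
  ... | a , b , c , d , cyc , o =
    no-cyclic-1423 av (order 1st 3rd tt) (order 3rd 4th tt) (order 4th 2nd tt) cyc
    where order = orderIso-< (a ∷ b ∷ c ∷ d ∷ []) p1423 o
  ¬1432 : ¬ T (cycContains (0 ∷ τ) p1432)
  ¬1432 occ with cycContains4⇒ (0 ∷ τ) occ
  ... | a , b , c , d , cyc , o =
    no-cyclic-1432 av (order 1st 4th tt) (order 4th 3rd tt) (order 3rd 2nd tt) cyc
    where order = orderIso-< (a ∷ b ∷ c ∷ d ∷ []) p1432 o

T-cycAvoidsB : ∀ τ → All (0 <_) τ → T (cycAvoidsB τ) ⇔ AvoidsA (reverse τ)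
T-cycAvoidsB τ 0<τ = mk⇔ (cycAvoidsB⇒AvoidsA-reverse τ 0<τ) (AvoidsA-reverse⇒cycAvoidsB τ)

cycAvoidsB≡cycAvoidsA-reverse : ∀ τ → All (0 <_) τ → cycAvoidsB τ ≡ cycAvoidsA (reverse τ)
cycAvoidsB≡cycAvoidsA-reverse τ 0<τ =
  T-injective (⇔.trans (T-cycAvoidsB τ 0<τ) (⇔.sym (T-cycAvoidsA (reverse τ) (All-resp-↭ (↭-sym (↭-reverse τ)) 0<τ))))

-- Inserting a new minimum

AllowedA : List ℕ → List ℕ → Set
AllowedA p ys = ys ≡ [] ⊎ (Decreasing (p ++ ys) × (p ≡ [] ⊎ length ys ≡ 1))

module InsertMinimum {x : ℕ} (p ys : List ℕ) (x<ρ : All (x <_) (p ++ ys)) where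

  x<p : ∀ {t} → t ⊆ p → All (x <_) t
  x<p s = All-resp-⊆ s (++⁻ˡ p x<ρ)

  x<ys : ∀ {t} → t ⊆ ys → All (x <_) t
  x<ys s = All-resp-⊆ s (++⁻ʳ p x<ρ)

  ascent-across : ∀ {a b} → a ∷ [] ⊆ p → b ∷ [] ⊆ ys → AllowedA p ys → ¬ a < b
  ascent-across _  () (inj₁ refl)
  ascent-across sa sb (inj₂ (dec , _)) a<b = <-asym a<b (AllPairs-⊆ dec (++⁺ sa sb))

  -- x lies below every entry of ρ, so in an occurrence through x it must play the pattern's 1;
  -- AllowedA rules out that remaining placement.
  no123-through-x : ∀ {a b c} t₁ {t₂} → a ∷ b ∷ c ∷ [] ≡ t₁ ++ x ∷ t₂ → t₁ ⊆ p → t₂ ⊆ ys →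
    AllowedA p ys → a < b → b < c → ⊥
  no123-through-x []              refl _  () (inj₁ refl) _ _
  no123-through-x []              refl _  s₂ (inj₂ (dec , _)) _ b<c = <-asym b<c (AllPairs-⊆ dec (++⁺ˡ p s₂))
  no123-through-x (_ ∷ [])        refl s₁ _ _ a<x _ = <-asym a<x (All.head (x<p s₁))
  no123-through-x (_ ∷ _ ∷ [])    refl s₁ _ _ _ b<x = <-asym b<x (All.head (All.tail (x<p s₁)))
  no123-through-x (_ ∷ _ ∷ _ ∷ [])    ()
  no123-through-x (_ ∷ _ ∷ _ ∷ _ ∷ _) ()

  no213-through-x : ∀ {a b c} t₁ {t₂} → a ∷ b ∷ c ∷ [] ≡ t₁ ++ x ∷ t₂ → t₁ ⊆ p → t₂ ⊆ ys →
    AllowedA p ys → b < a → a < c → ⊥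
  no213-through-x []              refl _  s₂ _ b<x _ = <-asym b<x (All.head (x<ys s₂))
  no213-through-x (_ ∷ [])        refl s₁ s₂ allowed _ a<c = ascent-across s₁ s₂ allowed a<c
  no213-through-x (_ ∷ _ ∷ [])    refl s₁ _ _ _ a<x = <-asym a<x (All.head (x<p s₁))
  no213-through-x (_ ∷ _ ∷ _ ∷ [])    ()
  no213-through-x (_ ∷ _ ∷ _ ∷ _ ∷ _) ()

  no3412-through-x : ∀ {a b c d} t₁ {t₂} → a ∷ b ∷ c ∷ d ∷ [] ≡ t₁ ++ x ∷ t₂ → t₁ ⊆ p → t₂ ⊆ ys →
    AllowedA p ys → c < d → d < a → a < b → ⊥
  no3412-through-x []                  refl _  s₂ _ _ d<x _ = <-asym d<x (All.head (All.tail (All.tail (x<ys s₂))))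
  no3412-through-x (_ ∷ [])            refl s₁ _  _ _ _ a<x = <-asym a<x (All.head (x<p s₁))
  no3412-through-x (_ ∷ _ ∷ [])        refl _  () (inj₁ refl) _ _ _
  no3412-through-x (_ ∷ _ ∷ [])        refl s₁ _  (inj₂ (dec , _)) _ _ a<b = <-asym a<b (AllPairs-⊆ dec (++⁺ʳ ys s₁))
  no3412-through-x (_ ∷ _ ∷ _ ∷ [])    refl s₁ _  _ c<x _ _ = <-asym c<x (All.head (All.tail (All.tail (x<p s₁))))
  no3412-through-x (_ ∷ _ ∷ _ ∷ _ ∷ [])    ()
  no3412-through-x (_ ∷ _ ∷ _ ∷ _ ∷ _ ∷ _) ()

  no4132-through-x : ∀ {a b c d} t₁ {t₂} → a ∷ b ∷ c ∷ d ∷ [] ≡ t₁ ++ x ∷ t₂ → t₁ ⊆ p → t₂ ⊆ ys →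
    AllowedA p ys → b < d → d < c → c < a → ⊥
  no4132-through-x []                  refl _  s₂ _ _ _ c<x = <-asym c<x (All.head (All.tail (x<ys s₂)))
  no4132-through-x (_ ∷ [])            refl _  () (inj₁ refl) _ _ _
  no4132-through-x (_ ∷ [])            refl () _  (inj₂ (_ , inj₁ refl)) _ _ _
  no4132-through-x (_ ∷ [])            refl _  s₂ (inj₂ (_ , inj₂ |ys|≡1)) _ _ _ = no-pair-in-singleton |ys|≡1 s₂
  no4132-through-x (_ ∷ _ ∷ [])        refl _  s₂ _ _ d<x _ = <-asym d<x (All.head (x<ys s₂))
  no4132-through-x (_ ∷ _ ∷ _ ∷ [])    refl s₁ _  _ b<x _ _ = <-asym b<x (All.head (All.tail (x<p s₁)))
  no4132-through-x (_ ∷ _ ∷ _ ∷ _ ∷ [])    ()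
  no4132-through-x (_ ∷ _ ∷ _ ∷ _ ∷ _ ∷ _) ()

  insert-min⇐ : AvoidsA (p ++ ys) → AllowedA p ys → AvoidsA (p ++ x ∷ ys)
  insert-min⇐ (no123 , no213 , no3412 , no4132) allowed = no123′ , no213′ , no3412′ , no4132′
    where
    no123′ : ¬ Occurs Is123 (p ++ x ∷ ys)
    no123′ (t@(_ ∷ _ ∷ _ ∷ []) , s , a<b , b<c) with ⊆-insert p s
    ... | inj₁ s′                      = no123 (t , s′ , a<b , b<c)
    ... | inj₂ (t₁ , _ , eq , s₁ , s₂) = no123-through-x t₁ eq s₁ s₂ allowed a<b b<c
    no213′ : ¬ Occurs Is213 (p ++ x ∷ ys)
    no213′ (t@(_ ∷ _ ∷ _ ∷ []) , s , b<a , a<c) with ⊆-insert p s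
    ... | inj₁ s′                      = no213 (t , s′ , b<a , a<c)
    ... | inj₂ (t₁ , _ , eq , s₁ , s₂) = no213-through-x t₁ eq s₁ s₂ allowed b<a a<c
    no3412′ : ¬ Occurs Is3412 (p ++ x ∷ ys)
    no3412′ (t@(_ ∷ _ ∷ _ ∷ _ ∷ []) , s , c<d , d<a , a<b) with ⊆-insert p s
    ... | inj₁ s′                      = no3412 (t , s′ , c<d , d<a , a<b)
    ... | inj₂ (t₁ , _ , eq , s₁ , s₂) = no3412-through-x t₁ eq s₁ s₂ allowed c<d d<a a<b
    no4132′ : ¬ Occurs Is4132 (p ++ x ∷ ys)
    no4132′ (t@(_ ∷ _ ∷ _ ∷ _ ∷ []) , s , b<d , d<c , c<a) with ⊆-insert p s
    ... | inj₁ s′                      = no4132 (t , s′ , b<d , d<c , c<a)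
    ... | inj₂ (t₁ , _ , eq , s₁ , s₂) = no4132-through-x t₁ eq s₁ s₂ allowed b<d d<c c<a

-- An ascent a < b in ρ would give, together with x, an occurrence of 123 (a, b both after x),
-- of 213 (x between a and b), or, together with z, of 3412 (a, b both before x).
decreasing-before-insert : ∀ {x} p z zs → let ρ = p ++ z ∷ zs in
  All (x <_) ρ → Unique ρ → AvoidsA (p ++ x ∷ z ∷ zs) → Decreasing ρ
decreasing-before-insert {x} p z zs x<ρ uniq (no123 , no213 , no3412 , _) = ⊆-AllPairs _ descent
  where
  open InsertMinimum p (z ∷ zs) x<ρ
  across : ∀ {a b} → a ∷ [] ⊆ p → b ∷ [] ⊆ z ∷ zs → b < a
  across sa sb = ≮∧≢⇒> (λ a<b → no213 (_ , ++⁺ sa (refl ∷ sb) , All.head (x<p sa) , a<b)) (AllPairs-⊆ uniq (++⁺ sa sb))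
  within-ys : ∀ {a b} → a ∷ b ∷ [] ⊆ z ∷ zs → b < a
  within-ys s = ≮∧≢⇒> (λ a<b → no123 (_ , ++⁺ˡ p (refl ∷ s) , All.head (x<ys s) , a<b)) (AllPairs-⊆ uniq (++⁺ˡ p s))
  within-p : ∀ {a b} → a ∷ b ∷ [] ⊆ p → b < a
  within-p s = ≮∧≢⇒>
    (λ a<b → no3412 (_ , ++⁺ s (refl ∷ refl ∷ minimum zs) , All.head (x<ys (refl ∷ minimum zs)) , z<a , a<b))
    (AllPairs-⊆ uniq (++⁺ʳ _ s))
    where z<a = across (⊆-trans (refl ∷ minimum _) s) (refl ∷ minimum zs)
  descent : ∀ {a b} → a ∷ b ∷ [] ⊆ p ++ z ∷ zs → b < a
  descent s with ⊆-split p s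
  ... | []           , _     , refl , _  , s₂ = within-ys s₂
  ... | _ ∷ []       , _     , refl , s₁ , s₂ = across s₁ s₂
  ... | _ ∷ _ ∷ []   , []    , refl , s₁ , _  = within-p s₁
  ... | _ ∷ _ ∷ []   , _ ∷ _ , () , _ , _
  ... | _ ∷ _ ∷ _ ∷ _ , _    , () , _ , _

insert-min⇒ : ∀ {x} p ys → All (x <_) (p ++ ys) → Unique (p ++ ys) → AvoidsA (p ++ x ∷ ys) → AllowedA p ys
insert-min⇒ p        []           _   _    _  = inj₁ refl
insert-min⇒ []       (z ∷ zs)     x<ρ uniq av = inj₂ (decreasing-before-insert [] z zs x<ρ uniq av , inj₁ refl)
insert-min⇒ (w ∷ ws) (z ∷ [])     x<ρ uniq av = inj₂ (decreasing-before-insert (w ∷ ws) z [] x<ρ uniq av , inj₂ refl)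
insert-min⇒ {x} (w ∷ ws) (z ∷ z′ ∷ zs) x<ρ uniq av@(_ , _ , _ , no4132) =
  ⊥-elim (no4132 (_ , refl ∷ ++⁺ˡ ws (refl ∷ refl ∷ refl ∷ minimum zs) , x<z′ , z′<z , z<w))
  where
  dec = decreasing-before-insert (w ∷ ws) z (z′ ∷ zs) x<ρ uniq av
  x<z′ = All.head (All.tail (++⁻ʳ (w ∷ ws) x<ρ))
  z′<z = AllPairs-⊆ dec (++⁺ˡ (w ∷ ws) (refl ∷ refl ∷ minimum zs))
  z<w  = AllPairs-⊆ dec (refl ∷ ++⁺ˡ ws (refl ∷ minimum _))

Decreasing-insert-min : ∀ {x} p ys → All (x <_) (p ++ ys) →
  Decreasing (p ++ x ∷ ys) ⇔ (Decreasing (p ++ ys) × ys ≡ [])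
Decreasing-insert-min {x} p [] x<p = mk⇔ (λ dec → restrict dec , refl) (λ (dec , _) → extend dec)
  where
  restrict : Decreasing (p ++ x ∷ []) → Decreasing (p ++ [])
  restrict dec = ⊆-AllPairs _ (λ s → AllPairs-⊆ dec (⊆-trans s (++⁺ ⊆-refl (x ∷ʳ []))))
  extend : Decreasing (p ++ []) → Decreasing (p ++ x ∷ [])
  extend dec = AllPairsₚ.++⁺ (subst Decreasing (++-identityʳ p) dec) ([] ∷ []) (All.map (_∷ []) (++⁻ˡ p x<p))
Decreasing-insert-min p (z ∷ zs) x<ρ = mk⇔ (⊥-elim ∘ x≮z) (λ ())
  where
  x≮z : ¬ Decreasing (p ++ _ ∷ z ∷ zs)
  x≮z dec = <-asym (All.head (++⁻ʳ p x<ρ)) (AllPairs-⊆ dec (++⁺ˡ p (refl ∷ refl ∷ minimum zs)))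

allowedA : Bool → List ℕ → List ℕ → Bool
allowedA false _ ys = null ys
allowedA true  p ys = null p ∨ (length ys <ᵇ 2)

T-allowedA : ∀ d p ys → (T d ⇔ Decreasing (p ++ ys)) → T (allowedA d p ys) ⇔ AllowedA p ys
T-allowedA false _        []           _  = mk⇔ (λ _ → inj₁ refl) (λ _ → tt)
T-allowedA false _        (_ ∷ _)      d⇔ = mk⇔ (λ ()) λ { (inj₁ ()) ; (inj₂ (dec , _)) → Equivalence.from d⇔ dec }
T-allowedA true  []       []           _  = mk⇔ (λ _ → inj₁ refl) (λ _ → tt)
T-allowedA true  []       (_ ∷ _)      d⇔ = mk⇔ (λ _ → inj₂ (Equivalence.to d⇔ tt , inj₁ refl)) (λ _ → tt)
T-allowedA true  (_ ∷ _)  []           _  = mk⇔ (λ _ → inj₁ refl) (λ _ → tt)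
T-allowedA true  (_ ∷ _)  (_ ∷ [])     d⇔ = mk⇔ (λ _ → inj₂ (Equivalence.to d⇔ tt , inj₂ refl)) (λ _ → tt)
T-allowedA true  (_ ∷ _)  (_ ∷ _ ∷ _)  _  = mk⇔ (λ ()) λ { (inj₁ ()) ; (inj₂ (_ , inj₁ ())) ; (inj₂ (_ , inj₂ ())) }

AvoidsA-insert-min : ∀ {x} p ys → All (x <_) (p ++ ys) → Unique (p ++ ys) →
  AvoidsA (p ++ x ∷ ys) ⇔ (AvoidsA (p ++ ys) × AllowedA p ys)
AvoidsA-insert-min {x} p ys x<ρ uniq = mk⇔
  (λ av → AvoidsA-⊆ (++⁺ ⊆-refl (x ∷ʳ ⊆-refl)) av , insert-min⇒ p ys x<ρ uniq av)
  (λ (av , allowed) → InsertMinimum.insert-min⇐ p ys x<ρ av allowed)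

cycAvoidsA-insert-min : ∀ {x} p ys → 0 < x → All (x <_) (p ++ ys) → Unique (p ++ ys) →
  cycAvoidsA (p ++ x ∷ ys) ≡ cycAvoidsA (p ++ ys) ∧ allowedA (decreasing (p ++ ys)) p ys
cycAvoidsA-insert-min {x} p ys 0<x x<ρ uniq = T-injective (⇔.trans before (⇔.sym after))
  where
  ρ = p ++ ys
  0<ρ : All (0 <_) ρ
  0<ρ = All.map (<-trans 0<x) x<ρ
  0<σ : All (0 <_) (p ++ x ∷ ys)
  0<σ = All-resp-↭ (↭-sym (shift x p ys)) (0<x ∷ 0<ρ)
  before : T (cycAvoidsA (p ++ x ∷ ys)) ⇔ (AvoidsA ρ × AllowedA p ys)
  before = ⇔.trans (T-cycAvoidsA _ 0<σ) (AvoidsA-insert-min p ys x<ρ uniq)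
  after : T (cycAvoidsA ρ ∧ allowedA (decreasing ρ) p ys) ⇔ (AvoidsA ρ × AllowedA p ys)
  after = ⇔.trans T-∧ (T-cycAvoidsA ρ 0<ρ ×-⇔ T-allowedA (decreasing ρ) p ys (T-decreasing ρ))

decreasing-insert-min : ∀ {x} p ys → All (x <_) (p ++ ys) →
  decreasing (p ++ x ∷ ys) ≡ decreasing (p ++ ys) ∧ null ys
decreasing-insert-min p ys x<ρ = T-injective (⇔.trans before (⇔.sym after))
  where
  before = ⇔.trans (T-decreasing _) (Decreasing-insert-min p ys x<ρ)
  after  = ⇔.trans T-∧ (T-decreasing _ ×-⇔ T-null ys)

decreasing⇒cycAvoidsA : ∀ ρ → T (decreasing ρ) → T (cycAvoidsA ρ)
decreasing⇒cycAvoidsA ρ = AvoidsA⇒cycAvoidsA ρ ∘ Decreasing⇒AvoidsA ∘ Equivalence.to (T-decreasing ρ)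

-- Counting

count : ∀ {A : Set} → (A → Bool) → List A → ℕ
count f = length ∘ filterᵇ f

module _ {A : Set} (f : A → Bool) where

  count-[_] : ∀ a → count f (a ∷ []) ≡ (if f a then 1 else 0)
  count-[ a ] with f a
  ... | true  = refl
  ... | false = refl

  count-++ : ∀ as bs → count f (as ++ bs) ≡ count f as + count f bs
  count-++ as bs = trans (cong length (filter-++ (T? ∘ f) as bs)) (length-++ (filterᵇ f as))

  count-↭ : ∀ {as bs} → as ↭ bs → count f as ≡ count f bs
  count-↭ = ↭-length ∘ filter-↭ (T? ∘ f)

  count-map : ∀ {B : Set} (g : B → A) bs → count f (map g bs) ≡ count (f ∘ g) bs
  count-map g []       = refl
  count-map g (b ∷ bs) with f (g b)
  ... | true  = cong suc (count-map g bs)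
  ... | false = count-map g bs

count-cong : ∀ {A : Set} {f g : A → Bool} {as} → All (λ a → f a ≡ g a) as → count f as ≡ count g as
count-cong                        []            = refl
count-cong {f = f} {g} {a ∷ _} (fa≡ga ∷ eqs) with f a | g a | fa≡ga
... | true  | .true  | refl = cong suc (count-cong eqs)
... | false | .false | refl = count-cong eqs

count-const-false : ∀ {A : Set} (as : List A) → count (λ _ → false) as ≡ 0
count-const-false []       = refl
count-const-false (_ ∷ as) = count-const-false as

count-concatMap : ∀ (f h : List ℕ → Bool) k (g : List ℕ → List (List ℕ)) L →
  All (λ ρ → count f (g ρ) ≡ count f (ρ ∷ []) + k * count h (ρ ∷ [])) L →
  count f (concatMap g L) ≡ count f L + k * count h L
count-concatMap f h k g []      []           = sym (*-zeroʳ k)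
count-concatMap f h k g (ρ ∷ L) (step ∷ steps) = begin
  count f (g ρ ++ concatMap g L)
    ≡⟨ count-++ f (g ρ) (concatMap g L) ⟩
  count f (g ρ) + count f (concatMap g L)
    ≡⟨ cong₂ _+_ step (count-concatMap f h k g L steps) ⟩
  (count f [ρ] + k * count h [ρ]) + (count f L + k * count h L)
    ≡⟨ interchange (count f [ρ]) (k * count h [ρ]) (count f L) (k * count h L) ⟩
  (count f [ρ] + count f L) + (k * count h [ρ] + k * count h L)
    ≡⟨ cong₂ _+_ (count-++ f [ρ] L) (trans (cong (k *_) (count-++ h [ρ] L)) (*-distribˡ-+ k (count h [ρ]) (count h L))) ⟨
  count f (ρ ∷ L) + k * count h (ρ ∷ L)
    ∎
  where
  open ≡-Reasoning
  [ρ] = ρ ∷ []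

splits : ∀ {A : Set} → List A → List (List A × List A)
splits []       = ([] , []) ∷ []
splits (y ∷ ys) = ([] , y ∷ ys) ∷ map (map₁ (y ∷_)) (splits ys)

splits-sound : ∀ {A : Set} (ρ : List A) → All (λ s → proj₁ s ++ proj₂ s ≡ ρ) (splits ρ)
splits-sound []       = refl ∷ []
splits-sound (y ∷ ys) = refl ∷ map⁺ (All.map (cong (y ∷_)) (splits-sound ys))

insertions≡splits : ∀ x ρ → insertions x ρ ≡ map (λ s → proj₁ s ++ x ∷ proj₂ s) (splits ρ)
insertions≡splits x []       = refl
insertions≡splits x (y ∷ ys) = cong ((x ∷ y ∷ ys) ∷_) (begin
  map (y ∷_) (insertions x ys)                                   ≡⟨ cong (map (y ∷_)) (insertions≡splits x ys) ⟩
  map (y ∷_) (map (λ s → proj₁ s ++ x ∷ proj₂ s) (splits ys))  ≡⟨ map-∘ (splits ys) ⟨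
  map (λ s → y ∷ proj₁ s ++ x ∷ proj₂ s) (splits ys)            ≡⟨ map-∘ (splits ys) ⟩
  map (λ s → proj₁ s ++ x ∷ proj₂ s) (map (map₁ (y ∷_)) (splits ys)) ∎)
  where open ≡-Reasoning

count-insertions : ∀ (f : List ℕ → Bool) b (allowed : List ℕ → List ℕ → Bool) x ρ →
  (∀ p ys → p ++ ys ≡ ρ → f (p ++ x ∷ ys) ≡ b ∧ allowed p ys) →
  count f (insertions x ρ) ≡ (if b then count (uncurry allowed) (splits ρ) else 0)
count-insertions f b allowed x ρ law = begin
  count f (insertions x ρ)
    ≡⟨ cong (count f) (insertions≡splits x ρ) ⟩
  count f (map (λ s → proj₁ s ++ x ∷ proj₂ s) (splits ρ))
    ≡⟨ count-map f _ (splits ρ) ⟩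
  count (λ s → f (proj₁ s ++ x ∷ proj₂ s)) (splits ρ)
    ≡⟨ count-cong (All.map (λ {s} → law (proj₁ s) (proj₂ s)) (splits-sound ρ)) ⟩
  count (λ s → b ∧ uncurry allowed s) (splits ρ)
    ≡⟨ by-cases b ⟩
  (if b then count (uncurry allowed) (splits ρ) else 0)
    ∎
  where
  open ≡-Reasoning
  by-cases : ∀ b → count (λ s → b ∧ uncurry allowed s) (splits ρ) ≡ (if b then count (uncurry allowed) (splits ρ) else 0)
  by-cases true  = refl
  by-cases false = count-const-false (splits ρ)

count-splits-end : ∀ (ρ : List ℕ) → count (λ s → null (proj₂ s)) (splits ρ) ≡ 1
count-splits-end []      = refl
count-splits-end (y ∷ ρ) = trans (count-map (λ s → null (proj₂ s)) (map₁ (y ∷_)) (splits ρ)) (count-splits-end ρ)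

count-splits-short-end : ∀ (ρ : List ℕ) → count (λ s → length (proj₂ s) <ᵇ 2) (splits ρ) ≡ 1 + 1 ⊓ length ρ
count-splits-short-end []          = refl
count-splits-short-end (_ ∷ [])    = refl
count-splits-short-end (y ∷ z ∷ ρ) =
  trans (count-map (λ s → length (proj₂ s) <ᵇ 2) (map₁ (y ∷_)) (splits (z ∷ ρ))) (count-splits-short-end (z ∷ ρ))

count-splits-allowedA : ∀ d (ρ : List ℕ) → count (uncurry (allowedA d)) (splits ρ) ≡ (if d then 1 + 2 ⊓ length ρ else 1)
count-splits-allowedA false ρ       = count-splits-end ρ
count-splits-allowedA true  []      = refl
count-splits-allowedA true  (y ∷ ρ) =
  cong suc (trans (count-map (uncurry (allowedA true)) (map₁ (y ∷_)) (splits ρ)) (count-splits-short-end ρ))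

count-insert-decreasing : ∀ x ρ → All (x <_) ρ → count decreasing (insertions x ρ) ≡ count decreasing (ρ ∷ [])
count-insert-decreasing x ρ x<ρ = begin
  count decreasing (insertions x ρ)
    ≡⟨ count-insertions decreasing _ (λ _ ys → null ys) x ρ law ⟩
  (if decreasing ρ then count (λ s → null (proj₂ s)) (splits ρ) else 0)
    ≡⟨ cong (λ n → if decreasing ρ then n else 0) (count-splits-end ρ) ⟩
  (if decreasing ρ then 1 else 0)
    ≡⟨ count-[ decreasing ] ρ ⟨
  count decreasing (ρ ∷ [])
    ∎
  where
  open ≡-Reasoning
  law : ∀ p ys → p ++ ys ≡ ρ → decreasing (p ++ x ∷ ys) ≡ decreasing ρ ∧ null ys
  law p ys refl = decreasing-insert-min p ys x<ρ

count-insert-cycAvoidsA : ∀ x ρ → 0 < x → All (x <_) ρ → Unique ρ →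
  count cycAvoidsA (insertions x ρ) ≡ count cycAvoidsA (ρ ∷ []) + 2 ⊓ length ρ * count decreasing (ρ ∷ [])
count-insert-cycAvoidsA x ρ 0<x x<ρ uniq = begin
  count cycAvoidsA (insertions x ρ)
    ≡⟨ count-insertions cycAvoidsA _ (allowedA (decreasing ρ)) x ρ law ⟩
  (if cycAvoidsA ρ then count (uncurry (allowedA (decreasing ρ))) (splits ρ) else 0)
    ≡⟨ cong (λ n → if cycAvoidsA ρ then n else 0) (count-splits-allowedA (decreasing ρ) ρ) ⟩
  (if cycAvoidsA ρ then (if decreasing ρ then 1 + k else 1) else 0)
    ≡⟨ tally (cycAvoidsA ρ) (decreasing ρ) (decreasing⇒cycAvoidsA ρ) ⟩
  (if cycAvoidsA ρ then 1 else 0) + k * (if decreasing ρ then 1 else 0)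
    ≡⟨ cong₂ (λ a d → a + k * d) (count-[ cycAvoidsA ] ρ) (count-[ decreasing ] ρ) ⟨
  count cycAvoidsA (ρ ∷ []) + k * count decreasing (ρ ∷ [])
    ∎
  where
  open ≡-Reasoning
  k = 2 ⊓ length ρ
  law : ∀ p ys → p ++ ys ≡ ρ → cycAvoidsA (p ++ x ∷ ys) ≡ cycAvoidsA ρ ∧ allowedA (decreasing ρ) p ys
  law p ys refl = cycAvoidsA-insert-min p ys 0<x x<ρ uniq
  tally : ∀ a d → (T d → T a) →
    (if a then (if d then 1 + k else 1) else 0) ≡ (if a then 1 else 0) + k * (if d then 1 else 0)
  tally true  true  _   = cong suc (sym (*-identityʳ k))
  tally true  false _   = cong suc (sym (*-zeroʳ k))
  tally false false _   = sym (*-zeroʳ k)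
  tally false true  d⇒a = ⊥-elim (d⇒a tt)

insertions-↭ : ∀ x ρ → All (_↭ x ∷ ρ) (insertions x ρ)
insertions-↭ x ρ = subst (All (_↭ x ∷ ρ)) (sym (insertions≡splits x ρ))
  (map⁺ (All.map (λ {s} eq → subst (λ ρ′ → _ ↭ x ∷ ρ′) eq (shift x (proj₁ s) (proj₂ s))) (splits-sound ρ)))

perms-↭ : ∀ l → All (_↭ l) (perms l)
perms-↭ []       = ↭-refl ∷ []
perms-↭ (x ∷ xs) = concat⁺ (map⁺ (All.map insert-x (perms-↭ xs)))
  where
  insert-x : ∀ {ρ} → ρ ↭ xs → All (_↭ x ∷ xs) (insertions x ρ)
  insert-x {ρ} ρ↭xs = All.map (λ σ↭ → ↭-trans σ↭ (↭-prep x ρ↭xs)) (insertions-↭ x ρ)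

insertions-∷ʳ : ∀ x ρ y →
  insertions x (ρ List.∷ʳ y) ≡ map (List._∷ʳ y) (insertions x ρ) List.∷ʳ (ρ List.∷ʳ y List.∷ʳ x)
insertions-∷ʳ x []      y = refl
insertions-∷ʳ x (z ∷ ρ) y = cong ((x ∷ z ∷ ρ List.∷ʳ y) ∷_) (begin
  map (z ∷_) (insertions x (ρ List.∷ʳ y))
    ≡⟨ cong (map (z ∷_)) (insertions-∷ʳ x ρ y) ⟩
  map (z ∷_) (map (List._∷ʳ y) (insertions x ρ) List.∷ʳ (ρ List.∷ʳ y List.∷ʳ x))
    ≡⟨ map-++ (z ∷_) (map (List._∷ʳ y) (insertions x ρ)) _ ⟩
  map (z ∷_) (map (List._∷ʳ y) (insertions x ρ)) List.∷ʳ (z ∷ ρ List.∷ʳ y List.∷ʳ x)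
    ≡⟨ cong (List._∷ʳ (z ∷ ρ List.∷ʳ y List.∷ʳ x)) (trans (sym (map-∘ (insertions x ρ))) (map-∘ (insertions x ρ))) ⟩
  map (List._∷ʳ y) (map (z ∷_) (insertions x ρ)) List.∷ʳ (z ∷ ρ List.∷ʳ y List.∷ʳ x)
    ∎)
  where open ≡-Reasoning

map-reverse-insertions : ∀ x ρ → map reverse (insertions x ρ) ↭ insertions x (reverse ρ)
map-reverse-insertions x []      = ↭-refl
map-reverse-insertions x (y ∷ ρ) = begin
  reverse (x ∷ y ∷ ρ) ∷ map reverse (map (y ∷_) (insertions x ρ))
    ≡⟨ cong₂ _∷_ (trans (unfold-reverse x (y ∷ ρ)) (cong (List._∷ʳ x) (unfold-reverse y ρ))) reverse-∘-cons ⟩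
  (reverse ρ List.∷ʳ y List.∷ʳ x) ∷ map (List._∷ʳ y) (map reverse (insertions x ρ))
    ↭⟨ ↭-prep _ (map⁺-↭ (List._∷ʳ y) (map-reverse-insertions x ρ)) ⟩
  (reverse ρ List.∷ʳ y List.∷ʳ x) ∷ map (List._∷ʳ y) (insertions x (reverse ρ))
    ↭⟨ ∷↭∷ʳ _ _ ⟩
  map (List._∷ʳ y) (insertions x (reverse ρ)) List.∷ʳ (reverse ρ List.∷ʳ y List.∷ʳ x)
    ≡⟨ insertions-∷ʳ x (reverse ρ) y ⟨
  insertions x (reverse ρ List.∷ʳ y)
    ≡⟨ cong (insertions x) (unfold-reverse y ρ) ⟨
  insertions x (reverse (y ∷ ρ))
    ∎
  where
  open PermutationReasoning
  reverse-∘-cons : map reverse (map (y ∷_) (insertions x ρ)) ≡ map (List._∷ʳ y) (map reverse (insertions x ρ))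
  reverse-∘-cons = trans (sym (map-∘ (insertions x ρ)))
                         (trans (map-cong (unfold-reverse y) (insertions x ρ)) (map-∘ (insertions x ρ)))

concat-↭ : ∀ {xss yss : List (List (List ℕ))} → xss ↭ yss → concat xss ↭ concat yss
concat-↭ ↭.refl           = ↭-refl
concat-↭ (↭.prep xs p)    = ++⁺ˡ-↭ xs (concat-↭ p)
concat-↭ (↭.swap xs ys p) = ↭-trans (shifts xs ys) (++⁺ˡ-↭ ys (++⁺ˡ-↭ xs (concat-↭ p)))
concat-↭ (↭.trans p q)    = ↭-trans (concat-↭ p) (concat-↭ q)

concatMap-↭ : ∀ {g h : List ℕ → List (List ℕ)} → (∀ ρ → g ρ ↭ h ρ) → ∀ L → concatMap g L ↭ concatMap h L
concatMap-↭ g↭h []      = ↭-refl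
concatMap-↭ g↭h (ρ ∷ L) = ++⁺-↭ (g↭h ρ) (concatMap-↭ g↭h L)

map-reverse-perms : ∀ l → map reverse (perms l) ↭ perms l
map-reverse-perms []       = ↭-refl
map-reverse-perms (x ∷ xs) = begin
  map reverse (concatMap (insertions x) (perms xs))       ≡⟨ map-concatMap reverse (insertions x) (perms xs) ⟩
  concatMap (map reverse ∘ insertions x) (perms xs)       ↭⟨ concatMap-↭ (map-reverse-insertions x) (perms xs) ⟩
  concatMap (insertions x ∘ reverse) (perms xs)           ≡⟨ concatMap-map (insertions x) reverse (perms xs) ⟨
  concatMap (insertions x) (map reverse (perms xs))       ↭⟨ concat-↭ (map⁺-↭ (insertions x) (map-reverse-perms xs)) ⟩
  concatMap (insertions x) (perms xs)                     ∎
  where open PermutationReasoning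

count-reverse-perms : ∀ (f : List ℕ → Bool) l → count (f ∘ reverse) (perms l) ≡ count f (perms l)
count-reverse-perms f l = trans (sym (count-map f reverse (perms l))) (count-↭ f (map-reverse-perms l))

startsWithMin-insertions : ∀ ρ → All (0 <_) ρ → filterᵇ startsWithMin (insertions 0 ρ) ≡ (0 ∷ ρ) ∷ []
startsWithMin-insertions []          _        = refl
startsWithMin-insertions (zero ∷ ρ)  (() ∷ _)
startsWithMin-insertions (suc y ∷ ρ) _ =
  cong ((0 ∷ suc y ∷ ρ) ∷_) (filter-none (T? ∘ startsWithMin) (map⁺ (All.universal (λ _ ()) (insertions 0 ρ))))

canonical-representatives : ∀ L → All (All (0 <_)) L → filterᵇ startsWithMin (concatMap (insertions 0) L) ≡ map (0 ∷_) L
canonical-representatives []      []           = refl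
canonical-representatives (ρ ∷ L) (0<ρ ∷ 0<L) = begin
  filterᵇ startsWithMin (insertions 0 ρ ++ concatMap (insertions 0) L)
    ≡⟨ filter-++ (T? ∘ startsWithMin) (insertions 0 ρ) _ ⟩
  filterᵇ startsWithMin (insertions 0 ρ) ++ filterᵇ startsWithMin (concatMap (insertions 0) L)
    ≡⟨ cong₂ _++_ (startsWithMin-insertions ρ 0<ρ) (canonical-representatives L 0<L) ⟩
  (0 ∷ ρ) ∷ map (0 ∷_) L
    ∎
  where open ≡-Reasoning

applyUpTo-suc-increasing : ∀ m → AllPairs _<_ (applyUpTo suc m)
applyUpTo-suc-increasing m = AllPairsₚ.applyUpTo⁺₁ suc m (λ i<j _ → s<s i<j)

applyUpTo-suc-positive : ∀ m → All (0 <_) (applyUpTo suc m)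
applyUpTo-suc-positive m = applyUpTo⁺₂ suc m (λ _ → z<s)

#Av-suc : ∀ Π m → #Av (suc m) Π ≡ count (λ τ → cycAvoidsAll Π (0 ∷ τ)) (perms (applyUpTo suc m))
#Av-suc Π m = trans (cong (count (cycAvoidsAll Π)) (canonical-representatives (perms l) 0<perms))
                    (count-map (cycAvoidsAll Π) (0 ∷_) (perms l))
  where
  l = applyUpTo suc m
  0<perms : All (All (0 <_)) (perms l)
  0<perms = All.map (λ σ↭l → All-resp-↭ (↭-sym σ↭l) (applyUpTo-suc-positive m)) (perms-↭ l)

avoidersA : ℕ → ℕ
avoidersA zero    = 1
avoidersA (suc m) = avoidersA m + 2 ⊓ m

avoidersA-closed : ∀ j → avoidersA (suc (suc j)) ≡ 2 * suc j
avoidersA-closed zero    = refl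
avoidersA-closed (suc j) = begin
  avoidersA (suc (suc j)) + 2   ≡⟨ cong (_+ 2) (avoidersA-closed j) ⟩
  2 * suc j + 2                 ≡⟨ +-comm (2 * suc j) 2 ⟩
  2 + 2 * suc j                 ≡⟨ *-suc 2 (suc j) ⟨
  2 * suc (suc j)               ∎
  where open ≡-Reasoning

count-decreasing-perms : ∀ l → AllPairs _<_ l → count decreasing (perms l) ≡ 1
count-decreasing-perms []       _             = refl
count-decreasing-perms (x ∷ xs) (x<xs ∷ inc) = begin
  count decreasing (concatMap (insertions x) (perms xs))  ≡⟨ count-concatMap decreasing decreasing 0 (insertions x) (perms xs) steps ⟩
  count decreasing (perms xs) + 0                         ≡⟨ +-identityʳ _ ⟩
  count decreasing (perms xs)                             ≡⟨ count-decreasing-perms xs inc ⟩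
  1                                                       ∎
  where
  open ≡-Reasoning
  step : ∀ {ρ} → ρ ↭ xs → count decreasing (insertions x ρ) ≡ count decreasing (ρ ∷ []) + 0
  step {ρ} ρ↭xs = trans (count-insert-decreasing x ρ (All-resp-↭ (↭-sym ρ↭xs) x<xs)) (sym (+-identityʳ _))
  steps = All.map step (perms-↭ xs)

count-cycAvoidsA-perms : ∀ l → AllPairs _<_ l → All (0 <_) l → count cycAvoidsA (perms l) ≡ avoidersA (length l)
count-cycAvoidsA-perms []       _             _            = refl
count-cycAvoidsA-perms (x ∷ xs) (x<xs ∷ inc) (0<x ∷ 0<xs) = begin
  count cycAvoidsA (concatMap (insertions x) (perms xs))
    ≡⟨ count-concatMap cycAvoidsA decreasing k (insertions x) (perms xs) (All.map step (perms-↭ xs)) ⟩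
  count cycAvoidsA (perms xs) + k * count decreasing (perms xs)
    ≡⟨ cong₂ (λ a d → a + k * d) (count-cycAvoidsA-perms xs inc 0<xs) (count-decreasing-perms xs inc) ⟩
  avoidersA (length xs) + k * 1
    ≡⟨ cong (avoidersA (length xs) +_) (*-identityʳ k) ⟩
  avoidersA (suc (length xs))
    ∎
  where
  open ≡-Reasoning
  k = 2 ⊓ length xs
  step : ∀ {ρ} → ρ ↭ xs → count cycAvoidsA (insertions x ρ) ≡ count cycAvoidsA (ρ ∷ []) + k * count decreasing (ρ ∷ [])
  step {ρ} ρ↭xs =
    subst (λ n → count cycAvoidsA (insertions x ρ) ≡ count cycAvoidsA (ρ ∷ []) + 2 ⊓ n * count decreasing (ρ ∷ []))
          (↭-length ρ↭xs) (count-insert-cycAvoidsA x ρ 0<x x<ρ uniq)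
    where
    x<ρ = All-resp-↭ (↭-sym ρ↭xs) x<xs
    uniq = ↭ₛ.Unique-resp-↭ (↭⇒↭ₛ (↭-sym ρ↭xs)) (AllPairs.map <⇒≢ inc)

#Av-ΠA : ∀ m → #Av (suc m) ΠA ≡ avoidersA m
#Av-ΠA m = begin
  #Av (suc m) ΠA                                ≡⟨ #Av-suc ΠA m ⟩
  count cycAvoidsA (perms (applyUpTo suc m))    ≡⟨ count-cycAvoidsA-perms _ (applyUpTo-suc-increasing m) (applyUpTo-suc-positive m) ⟩
  avoidersA (length (applyUpTo suc m))          ≡⟨ cong avoidersA (length-applyUpTo suc m) ⟩
  avoidersA m                                   ∎
  where open ≡-Reasoning

#Av-ΠB≡#Av-ΠA : ∀ n → #Av n ΠB ≡ #Av n ΠA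
#Av-ΠB≡#Av-ΠA zero    = refl
#Av-ΠB≡#Av-ΠA (suc m) = begin
  #Av (suc m) ΠB                           ≡⟨ #Av-suc ΠB m ⟩
  count cycAvoidsB (perms l)               ≡⟨ count-cong (All.map reversal (perms-↭ l)) ⟩
  count (cycAvoidsA ∘ reverse) (perms l)   ≡⟨ count-reverse-perms cycAvoidsA l ⟩
  count cycAvoidsA (perms l)               ≡⟨ #Av-suc ΠA m ⟨
  #Av (suc m) ΠA                           ∎
  where
  open ≡-Reasoning
  l = applyUpTo suc m
  reversal : ∀ {σ} → σ ↭ l → cycAvoidsB σ ≡ cycAvoidsA (reverse σ)
  reversal σ↭l = cycAvoidsB≡cycAvoidsA-reverse _ (All-resp-↭ (↭-sym σ↭l) (applyUpTo-suc-positive m))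

mainTheorem3 : ((n : ℕ) → #Av n (p1234 ∷ p1324 ∷ []) ≡ #Av n (p1423 ∷ p1432 ∷ []))
             × ((n : ℕ) → 3 ≤ n → #Av n (p1234 ∷ p1324 ∷ []) ≡ 2 * (n ∸ 2))
mainTheorem3 = (λ n → sym (#Av-ΠB≡#Av-ΠA n)) , count-for-n≥3
  where
  count-for-n≥3 : (n : ℕ) → 3 ≤ n → #Av n ΠA ≡ 2 * (n ∸ 2)
  count-for-n≥3 (suc (suc (suc j))) _                 = trans (#Av-ΠA (suc (suc j))) (avoidersA-closed j)
  count-for-n≥3 (suc zero)          (s≤s ())
  count-for-n≥3 (suc (suc zero))    (s≤s (s≤s ()))
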